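{- There does not exist an integer $k$ such that $f_4(n+k)=b_4(n)$ for all integers $n\ge -k$.
   Context: For an integer $n$, a hyperquaternary representation of $n$ is an expression $n=\sum_{i\ge 0}\epsilon_i 4^i$ with finitely many nonzero $\epsilon_i$ and all $\epsilon_i\in\{0,1,2,3,4\}$; $f_4(n)$ denotes the number of such representations (so $f_4(n)=0$ for $n<0$). A balanced quaternary representation of $n$ is an expression $n=\sum_{i\ge 0}\epsilon_i 4^i$ with finitely many nonzero $\epsilon_i$ and all $\epsilon_i\in\{ -2,-1,0,1,2\}$; $b_4(n)$ denotes the number of such representations. Representations differing only by leading zero digits are identified. -}

module Defs where

open import Data.Nat using (ℕ; zero; suc)
open import Data.Fin using (Fin; toℕ)
open import Data.Fin.Properties using (all?)
open import Data.Vec using (Vec; []; _∷_)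
open import Data.List using (List; []; _∷_; map; concatMap; length; filter)
open import Data.Integer using (ℤ; +_; -[1+_]; _+_; _*_; _-_; ∣_∣)
import Data.Integer.Properties as ℤP

allVecs : (L : ℕ) → List (Vec (Fin 5) L)
allVecs zero    = [] ∷ []
allVecs (suc L) = concatMap (λ v → map (λ d → d ∷ v) (Data.Vec.toList (Data.Vec.allFin 5))) (allVecs L)

value : (Fin 5 → ℤ) → {L : ℕ} → Vec (Fin 5) L → ℤ
value dig []      = + 0
value dig (d ∷ v) = dig d + + 4 * value dig v

hyperDigit : Fin 5 → ℤ
hyperDigit d = + toℕ d

balDigit : Fin 5 → ℤ
balDigit d = + toℕ d - + 2

countReps : (Fin 5 → ℤ) → ℕ → ℤ → ℕ
countReps dig L n = length (filter (λ v → value dig v ℤP.≟ n) (allVecs L))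

-- Representations modulo leading zeros correspond bijectively to
-- digit strings of a fixed length L, provided L exceeds the position of the
-- top nonzero digit of every representation of n. For n ≥ 0 any such
-- position j satisfies 4^j ≤ n, so L = n + 1 suffices; f₄(n) = 0 for n < 0.
f4 : ℤ → ℕ
f4 (+ n)    = countReps hyperDigit (suc n) (+ n)
f4 -[1+ n ] = 0

-- If the top nonzero digit is at position j, then
-- |n| ≥ 4^j − 2(4^j − 1)/3 = (4^j + 2)/3 > 4^(j−1), so j ≤ |n| + 1 and
-- L = |n| + 2 suffices.
b4 : ℤ → ℕ
b4 n = countReps balDigit (suc (suc ∣ n ∣)) n

{-# OPTIONS --safe #-}
module Submission where

-- f₄ equals 1 at 0, 1, 2 and 3 (the number itself is its only representation).
-- On the other hand every n ≡ 2 (mod 4) has at least two balanced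
-- representations: its last digit can be 2 or −2, followed by a balanced
-- representation of (n − 2)/4 or of (n + 2)/4 respectively, and every integer
-- has one (of length at most its absolute value). For any shift k one of j = 0, 1, 2, 3 has j − k ≡ 2 (mod 4),
-- and at n = j − k the identity would give 1 = f₄(j) = b₄(n) ≥ 2.

open import Defs
open import Data.Nat as ℕ using (ℕ; zero; suc; z≤n; s≤s)
import Data.Nat.Properties as ℕ
open import Data.Nat.DivMod using (_divMod_; result)
open import Data.Integer using (ℤ; +_; -[1+_]; _+_; _-_; -_; _*_; _≤_; ∣_∣)
import Data.Integer.Properties as ℤ
open import Data.Integer.DivMod using (_%ℕ_; _/ℕ_; a≡a%ℕn+[a/ℕn]*n; n%ℕd<d)
open import Data.Integer.Tactic.RingSolver using (solve-∀)
open import Data.Fin using (Fin; toℕ; opposite)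
open import Data.Fin.Patterns using (0F; 1F; 2F; 3F; 4F)
open import Data.Vec using (Vec; []; _∷_; map)
open import Data.Vec.Membership.Propositional.Properties using (∈-allFin⁺; ∈-toList⁺)
open import Data.List using (List; _∷_; length)
open import Data.List.Relation.Unary.Any using (here; there)
open import Data.List.Membership.Propositional using (_∈_; lose)
open import Data.List.Membership.Propositional.Properties
  using (∈-concatMap⁺; ∈-map⁺; ∈-filter⁺)
open import Data.Product using (Σ-syntax; ∃₂; ∃-syntax; _×_; _,_)
open import Relation.Nullary using (¬_; contradiction)
open import Relation.Binary.PropositionalEquality
  using (_≡_; _≢_; refl; sym; trans; cong; cong₂; subst; module ≡-Reasoning)

distinct-members⇒2≤length : ∀ {A : Set} {x y : A} {xs : List A} →
                            x ∈ xs → y ∈ xs → x ≢ y → 2 ℕ.≤ length xs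
distinct-members⇒2≤length {xs = _ ∷ _ ∷ _} _ _ _ = s≤s (s≤s z≤n)
distinct-members⇒2≤length (here refl) (here refl) x≢y = contradiction refl x≢y

∈-allVecs : ∀ {L} (v : Vec (Fin 5) L) → v ∈ allVecs L
∈-allVecs []      = here refl
∈-allVecs (d ∷ v) =
  ∈-concatMap⁺ _ (lose (∈-allVecs v) (∈-map⁺ (_∷ v) (∈-toList⁺ (∈-allFin⁺ d))))

2≤countReps : ∀ dig {L n} {u w : Vec (Fin 5) L} →
              u ≢ w → value dig u ≡ n → value dig w ≡ n → 2 ℕ.≤ countReps dig L n
2≤countReps dig {n = n} {u} {w} u≢w u↦n w↦n = distinct-members⇒2≤length
  (∈-filter⁺ P? (∈-allVecs u) u↦n) (∈-filter⁺ P? (∈-allVecs w) w↦n) u≢w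
  where P? = λ v → value dig v ℤ.≟ n

BalRep : ℕ → ℤ → Set
BalRep L x = Σ[ v ∈ Vec (Fin 5) L ] value balDigit v ≡ x

value-map-opposite : ∀ {dig L} → (∀ d → dig (opposite d) ≡ - dig d) →
                     (v : Vec (Fin 5) L) → value dig (map opposite v) ≡ - value dig v
value-map-opposite       dig-odd []      = refl
value-map-opposite {dig} dig-odd (d ∷ v) = trans
  (cong₂ (λ i j → i + + 4 * j) (dig-odd d) (value-map-opposite dig-odd v))
  (neg-step (dig d) (value dig v))
  where
  neg-step : ∀ i j → - i + + 4 * - j ≡ - (i + + 4 * j)
  neg-step = solve-∀

balDigit-opposite : ∀ d → balDigit (opposite d) ≡ - balDigit d
balDigit-opposite 0F = refl
balDigit-opposite 1F = refl
balDigit-opposite 2F = refl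
balDigit-opposite 3F = refl
balDigit-opposite 4F = refl

BalRep-neg : ∀ {L x} → BalRep L x → BalRep L (- x)
BalRep-neg (v , v↦x) =
  map opposite v , trans (value-map-opposite balDigit-opposite v) (cong -_ v↦x)

residue-digit-carry : ∀ (r : Fin 4) →
  ∃₂ λ d c → + toℕ r ≡ balDigit d + + 4 * + c × c ℕ.* 4 ℕ.≤ suc (toℕ r)
residue-digit-carry 0F = 2F , 0 , refl , z≤n
residue-digit-carry 1F = 3F , 0 , refl , z≤n
residue-digit-carry 2F = 4F , 0 , refl , z≤n
residue-digit-carry 3F = 1F , 1 , refl , ℕ.≤-refl

m*4≤2+n⇒m≤n : ∀ m n → m ℕ.* 4 ℕ.≤ 2 ℕ.+ n → m ℕ.≤ n
m*4≤2+n⇒m≤n zero    n _                   = z≤n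
m*4≤2+n⇒m≤n (suc m) n (s≤s (s≤s 2+m*4≤n)) =
  ℕ.≤-trans (s≤s (ℕ.m≤n⇒m≤1+n (ℕ.m≤m*n m 4))) 2+m*4≤n

carry-into-quotient : ∀ i c q {r} →
  + r ≡ i + + 4 * + c → + (r ℕ.+ q ℕ.* 4) ≡ i + + 4 * + (c ℕ.+ q)
carry-into-quotient i c q {r} r≡i+4c = begin
  + (r ℕ.+ q ℕ.* 4)           ≡⟨ ℤ.pos-+ r (q ℕ.* 4) ⟩
  + r + + (q ℕ.* 4)           ≡⟨ cong₂ _+_ r≡i+4c (ℤ.pos-* q 4) ⟩
  i + + 4 * + c + + q * + 4   ≡⟨ regroup i (+ c) (+ q) ⟩
  i + + 4 * (+ c + + q)       ≡⟨ cong (λ j → i + + 4 * j) (ℤ.pos-+ c q) ⟨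
  i + + 4 * + (c ℕ.+ q)       ∎
  where
  open ≡-Reasoning
  regroup : ∀ i c q → i + + 4 * c + q * + 4 ≡ i + + 4 * (c + q)
  regroup = solve-∀

balRep-pos : ∀ L m → m ℕ.≤ L → BalRep L (+ m)
balRep-pos zero    zero _ = [] , refl
balRep-pos (suc L) m m≤1+L with m divMod 4
... | result q r refl with residue-digit-carry r
...   | d , c , r≡d+4c , c*4≤1+r =
  let v , v↦c+q = balRep-pos L (c ℕ.+ q) c+q≤L
  in  d ∷ v , trans (cong (λ j → balDigit d + + 4 * j) v↦c+q)
                    (sym (carry-into-quotient (balDigit d) c q r≡d+4c))
  where
  c+q≤L : c ℕ.+ q ℕ.≤ L
  c+q≤L = m*4≤2+n⇒m≤n (c ℕ.+ q) L (begin
    (c ℕ.+ q) ℕ.* 4          ≡⟨ ℕ.*-distribʳ-+ 4 c q ⟩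
    c ℕ.* 4 ℕ.+ q ℕ.* 4      ≤⟨ ℕ.+-monoˡ-≤ (q ℕ.* 4) c*4≤1+r ⟩
    suc (toℕ r ℕ.+ q ℕ.* 4)  ≤⟨ s≤s m≤1+L ⟩
    2 ℕ.+ L                  ∎)
    where open ℕ.≤-Reasoning

balRep : ∀ L x → ∣ x ∣ ℕ.≤ L → BalRep L x
balRep L (+ m)    m≤L   = balRep-pos L m m≤L
balRep L -[1+ m ] 1+m≤L = BalRep-neg (balRep-pos L (suc m) 1+m≤L)

∣j∣≤∣i+4*j∣ : ∀ i j → ∣ i ∣ ℕ.≤ 2 → ∣ j ∣ ℕ.≤ ∣ i + + 4 * j ∣
∣j∣≤∣i+4*j∣ i j ∣i∣≤2 = m*4≤2+n⇒m≤n ∣ j ∣ ∣ i + + 4 * j ∣ (begin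
  ∣ j ∣ ℕ.* 4                  ≡⟨ ℕ.*-comm ∣ j ∣ 4 ⟩
  4 ℕ.* ∣ j ∣                  ≡⟨ ℤ.∣i*j∣≡∣i∣*∣j∣ (+ 4) j ⟨
  ∣ + 4 * j ∣                  ≡⟨ cong ∣_∣ (isolate i j) ⟩
  ∣ i + + 4 * j - i ∣          ≤⟨ ℤ.∣i-j∣≤∣i∣+∣j∣ (i + + 4 * j) i ⟩
  ∣ i + + 4 * j ∣ ℕ.+ ∣ i ∣    ≤⟨ ℕ.+-monoʳ-≤ ∣ i + + 4 * j ∣ ∣i∣≤2 ⟩
  ∣ i + + 4 * j ∣ ℕ.+ 2        ≡⟨ ℕ.+-comm ∣ i + + 4 * j ∣ 2 ⟩
  2 ℕ.+ ∣ i + + 4 * j ∣        ∎)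
  where
  open ℕ.≤-Reasoning
  isolate : ∀ i j → + 4 * j ≡ i + + 4 * j - i
  isolate = solve-∀

2≤b4[2+4a] : ∀ a → 2 ℕ.≤ b4 (+ 2 + + 4 * a)
2≤b4[2+4a] a =
  let u , u↦a   = balRep L a ∣a∣≤L
      w , w↦1+a = balRep L (+ 1 + a) ∣1+a∣≤L
  in  2≤countReps balDigit {u = 4F ∷ u} {0F ∷ w} (λ ())
        (cong (λ j → + 2 + + 4 * j) u↦a)
        (trans (cong (λ j → - + 2 + + 4 * j) w↦1+a) (lower-digit a))
  where
  L = suc ∣ + 2 + + 4 * a ∣
  lower-digit : ∀ a → - + 2 + + 4 * (+ 1 + a) ≡ + 2 + + 4 * a
  lower-digit = solve-∀
  ∣a∣≤L : ∣ a ∣ ℕ.≤ L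
  ∣a∣≤L = ℕ.m≤n⇒m≤1+n (∣j∣≤∣i+4*j∣ (+ 2) a ℕ.≤-refl)
  ∣1+a∣≤L : ∣ + 1 + a ∣ ℕ.≤ L
  ∣1+a∣≤L = ℕ.m≤n⇒m≤1+n (subst (λ n → ∣ + 1 + a ∣ ℕ.≤ ∣ n ∣) (lower-digit a)
                                 (∣j∣≤∣i+4*j∣ (- + 2) (+ 1 + a) ℕ.≤-refl))

f4[j]≡1 : ∀ {j} → j ℕ.< 4 → f4 (+ j) ≡ 1
f4[j]≡1 {0} _ = refl
f4[j]≡1 {1} _ = refl
f4[j]≡1 {2} _ = refl
f4[j]≡1 {3} _ = refl
f4[j]≡1 {suc (suc (suc (suc _)))} (s≤s (s≤s (s≤s (s≤s ()))))

shift-to-2-mod-4 : ∀ k → ∃₂ λ j a → j ℕ.< 4 × + j - k ≡ + 2 + + 4 * a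
shift-to-2-mod-4 k = j , - q , n%ℕd<d (k + + 2) 4 , (begin
  + j - k                       ≡⟨ regroup (+ j) k ⟩
  + 2 - (k + + 2 - + j)         ≡⟨ cong (λ m → + 2 - (m - + j)) (a≡a%ℕn+[a/ℕn]*n (k + + 2) 4) ⟩
  + 2 - (+ j + q * + 4 - + j)   ≡⟨ cancel (+ j) q ⟩
  + 2 + + 4 * - q               ∎)
  where
  open ≡-Reasoning
  j = (k + + 2) %ℕ 4
  q = (k + + 2) /ℕ 4
  regroup : ∀ j k → j - k ≡ + 2 - (k + + 2 - j)
  regroup = solve-∀
  cancel : ∀ j q → + 2 - (j + q * + 4 - j) ≡ + 2 + + 4 * - q
  cancel = solve-∀

theorem1p1 : ¬ (∃[ k ] (∀ (n : ℤ) → - k ≤ n → f4 (n + k) ≡ b4 n))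
theorem1p1 (k , f4≡b4) with shift-to-2-mod-4 k
... | j , a , j<4 , j-k≡2+4a = ℕ.<-irrefl refl (begin
  2                     ≤⟨ 2≤b4[2+4a] a ⟩
  b4 (+ 2 + + 4 * a)    ≡⟨ cong b4 j-k≡2+4a ⟨
  b4 (+ j - k)          ≡⟨ f4≡b4 (+ j - k) (ℤ.i≤j+i (- k) (+ j)) ⟨
  f4 (+ j - k + k)      ≡⟨ cong f4 (i-j+j≡i (+ j) k) ⟩
  f4 (+ j)              ≡⟨ f4[j]≡1 j<4 ⟩
  1                     ∎)
  where
  open ℕ.≤-Reasoning
  i-j+j≡i : ∀ i j → i - j + j ≡ i
  i-j+j≡i = solve-∀
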